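{- Let $\mathbf{x}\in\{0,1\}^m$. If $H(\mathbf{x})=0$, then $P_I(\mathbf{x})=0$ for each $1\le I\le 10$.
   Context: $\mathcal{N}$ is a rooted binary phylogenetic network on a finite set $X$ with vertices $v_0,\dots,v_{n_{\mathcal{N}}-1}$. That is, $\mathcal{N}$ is an acyclic digraph without parallel edges with a unique root (in-degree 0, out-degree 2, reaching all vertices), leaves of in-degree 1 forming $X$, and other vertices of in/out-degree $(1,2)$ or $(2,1)$. $\mathcal{T}$ is a rooted binary phylogenetic $X$-tree (no in-degree-2 vertices) with vertices $u_0,\dots,u_{n_{\mathcal{T}}-1}$, $u_0$ its root. Assume $n_{\mathcal{N}}\ge n_{\mathcal{T}}$, and let $s=1+\lfloor\log_2(n_{\mathcal{N}}-n_{\mathcal{T}})\rfloor$ if $n_{\mathcal{N}}>n_{\mathcal{T}}$ and $s=0$ otherwise. Tree vertices have out-degree 2, with children $v_{j_1},v_{j_2}$. Reticulation vertices have in-degree 2, with parents $v_{j^1},v_{j^2}$. $f(u_i,u_l)=1$ iff $(u_i,u_l)\in E(\mathcal{T})$, and $g(v_j,v_k)=1$ iff $(v_j,v_k)\in E(\mathcal{N})$. $\ell(i)$ is the index of the leaf of $\mathcal{N}$ labeled like leaf $u_i$ of $\mathcal{T}$. The binary variables (forming $\mathbf{x}\in\{0,1\}^m$) are: - $x_{i,j}$ ($0\le i\le n_{\mathcal{T}}$, $0\le j<n_{\mathcal{N}}$); - $y_{i,r}$ ($1\le i<n_{\mathcal{T}}$, $0\le r<s$); - $z_{i,j}$ ($i<n_{\mathcal{T}}$,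 $v_j$ tree or reticulation); - $\hat z_{i,2j},\hat z_{i,2j+1}$ ($u_i$ non-leaf, $v_j$ tree). With $i,l\in\{0,\dots,n_{\mathcal{T}}-1\}$ and $j,k\in\{0,\dots,n_{\mathcal{N}}-1\}$: - $P_1=(1-\sum_jx_{0,j})^2+\sum_{i=1}^{n_{\mathcal{T}}-1}(1-\sum_jx_{i,j}+\sum_{r=0}^{s-1}2^ry_{i,r})^2$; - $P_2=\sum_j(\sum_{i=0}^{n_{\mathcal{T}}}x_{i,j}-1)^2$; - $P_3=\sum_i\sum_{\text{tree }v_j}(x_{i,j_1}x_{i,j_2}-2x_{i,j_1}z_{i,j}-2x_{i,j_2}z_{i,j}+3z_{i,j})$; - $P_4=\sum_i\sum_{\text{tree }v_j}x_{i,j}z_{i,j}$; - $P_5=\sum_i\sum_{\text{ret. }v_j}(x_{i,j^1}x_{i,j^2}-2x_{i,j^1}z_{i,j}-2x_{i,j^2}z_{i,j}+3z_{i,j})$; - $P_6=\sum_i\sum_{\text{ret. }v_j}x_{i,j}z_{i,j}$; - $P_7=\sum_i\sum_{l\ne i}f(u_i,u_l)\sum_{\text{tree }v_j}x_{i,j}z_{l,j}$; - $P_8=\sum_{u_i\text{ non-leaf}}\sum_{\text{tree }v_j}(x_{i,j}x_{i,j_1}-2x_{i,j}\hat z_{i,2j}-2x_{i,j_1}\hat z_{i,2j}+3\hat z_{i,2j}+x_{i,j}x_{i,j_2}-2x_{i,j}\hat z_{i,2j+1}-2x_{i,j_2}\hat z_{i,2j+1}+3\hat z_{i,2j+1})$;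 - $P_9=\sum_i\sum_{l\ne i}f(u_i,u_l)\sum_{\text{tree }v_j}(\hat z_{i,2j}x_{l,j_2}+\hat z_{i,2j+1}x_{l,j_1})$; - $P_{10}=\sum_{u_i\text{ leaf}}(1-x_{i,\ell(i)})^2$; - $P_{11}=\sum_i\sum_jx_{i,j}(1-\sum_{k\ne j}g(v_j,v_k)x_{i,k})-n_{\mathcal{T}}$; - $P_{12}=\sum_i\sum_{l\ne i}f(u_i,u_l)(1-\sum_j\sum_{k\ne j}g(v_j,v_k)x_{i,j}x_{l,k})$. Finally, $H=B\sum_{I=1}^{10}P_I+AP_{11}+P_{12}$ with $A=2n_{\mathcal{N}}$ and $B=4n_{\mathcal{N}}^2n_{\mathcal{T}}^2$. -}

module Defs where

open import Data.Bool using (Bool; true; false; if_then_else_; T)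
open import Data.Nat as ℕ using (ℕ; zero; suc; _<ᵇ_)
open import Data.Nat.Logarithm using (⌊log₂_⌋)
open import Data.Fin as Fin using (Fin; toℕ; inject₁; fromℕ)
open import Data.Fin.Properties using (_≟_)
open import Data.List using (List; []; _∷_; length; filterᵇ)
open import Data.List using () renaming (allFin to allFinL)
open import Data.Integer as ℤ using (ℤ; +_; _+_; _-_; _*_)
open import Data.Product using (Σ; ∃; _×_; _,_)
open import Data.Sum using (_⊎_)
open import Function using (Injective)
open import Relation.Binary.PropositionalEquality using (_≡_; _≢_)
open import Relation.Nullary using (¬_)
open import Relation.Nullary.Decidable using (⌊_⌋)
open import Relation.Binary.Construct.Closure.Transitive using (TransClosure)
open import Relation.Binary.Construct.Closure.ReflexiveTransitive using (Star)

Digraph : ℕ → Set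
Digraph n = Fin n → Fin n → Bool

module _ {n : ℕ} (E : Digraph n) where

  Edge : Fin n → Fin n → Set
  Edge u v = T (E u v)

  children : Fin n → List (Fin n)
  children v = filterᵇ (λ w → E v w) (allFinL n)

  parents : Fin n → List (Fin n)
  parents v = filterᵇ (λ w → E w v) (allFinL n)

  outdeg indeg : Fin n → ℕ
  outdeg v = length (children v)
  indeg v = length (parents v)

record PhyloNet (n k : ℕ) : Set where
  field
    E       : Digraph n
    root    : Fin n
    leafLab : Fin k → Fin n
    acyclic : ∀ v → ¬ TransClosure (Edge E) v v
    root-in  : indeg E root ≡ 0
    root-out : outdeg E root ≡ 2
    root-reaches : ∀ v → Star (Edge E) root v
    degrees : ∀ v → v ≡ root
                  ⊎ (indeg E v ≡ 1 × outdeg E v ≡ 0)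
                  ⊎ (indeg E v ≡ 1 × outdeg E v ≡ 2)
                  ⊎ (indeg E v ≡ 2 × outdeg E v ≡ 1)
    leafLab-inj    : Injective _≡_ _≡_ leafLab
    leafLab-leaves : ∀ v → (outdeg E v ≡ 0 → ∃ λ a → leafLab a ≡ v)
    leafLab-isLeaf : ∀ a → outdeg E (leafLab a) ≡ 0

record PhyloTree (n k : ℕ) : Set where
  field
    net        : PhyloNet n k
    noRet      : ∀ v → indeg (PhyloNet.E net) v ≢ 2
    root-is-u₀ : toℕ (PhyloNet.root net) ≡ 0

∑ : ∀ {n} → (Fin n → ℤ) → ℤ
∑ {zero}  f = + 0
∑ {suc n} f = f Fin.zero + ∑ (λ i → f (Fin.suc i))

⟦_⟧ : Bool → ℤ
⟦ true ⟧  = + 1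
⟦ false ⟧ = + 0

sq : ℤ → ℤ
sq a = a * a

ifNe : ∀ {n} → Fin n → Fin n → ℤ → ℤ
ifNe i l t = if ⌊ i ≟ l ⌋ then + 0 else t

onTree : ∀ {n} → Digraph n → Fin n → (Fin n → Fin n → ℤ) → ℤ
onTree E j t with children E j
... | j₁ ∷ j₂ ∷ [] = t j₁ j₂
... | _ = + 0

onRet : ∀ {n} → Digraph n → Fin n → (Fin n → Fin n → ℤ) → ℤ
onRet E j t with parents E j
... | p₁ ∷ p₂ ∷ [] = t p₁ p₂
... | _ = + 0

isLeafᵇ : ∀ {n} → Digraph n → Fin n → Bool
isLeafᵇ E v with children E v
... | [] = true
... | _ ∷ _ = false

sParam : ℕ → ℕ → ℕ
sParam nN nT = if nT <ᵇ nN then suc ⌊log₂ (nN ℕ.∸ nT) ⌋ else 0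

-- Binary variables.  (A few entries are never used by H, e.g. y_{0,r},
-- z_{i,j} for leaves v_j, ẑ for leaf u_i or non-tree v_j; they are harmless.)

record Vars (nN nT : ℕ) : Set where
  field
    x  : Fin (suc nT) → Fin nN → Bool
    y  : Fin nT → Fin (sParam nN nT) → Bool
    z  : Fin nT → Fin nN → Bool
    ẑ  : Fin nT → Fin nN → Fin 2 → Bool        -- ẑ i j 0 = ẑ_{i,2j}, ẑ i j 1 = ẑ_{i,2j+1}

module QUBO {nN nT k : ℕ} (N : PhyloNet nN k) (T : PhyloTree nT k)
            (v : Vars nN nT) where

  private
    G : Fin nN → Fin nN → ℤ
    G j k' = ⟦ PhyloNet.E N j k' ⟧
    ET = PhyloNet.E (PhyloTree.net T)
    F : Fin nT → Fin nT → ℤ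
    F i l = ⟦ ET i l ⟧
    EN = PhyloNet.E N
    X : Fin nT → Fin nN → ℤ
    X i j = ⟦ Vars.x v (inject₁ i) j ⟧
    Z : Fin nT → Fin nN → ℤ
    Z i j = ⟦ Vars.z v i j ⟧
    Ẑ : Fin nT → Fin nN → Fin 2 → ℤ
    Ẑ i j b = ⟦ Vars.ẑ v i j b ⟧
    Y : Fin nT → Fin (sParam nN nT) → ℤ
    Y i r = ⟦ Vars.y v i r ⟧
    nonLeaf : Fin nT → ℤ → ℤ
    nonLeaf i t = if isLeafᵇ ET i then + 0 else t
    c2 c3 : ℤ
    c2 = + 2
    c3 = + 3

  P₁ : ℤ
  P₁ = ∑ λ i → if ⌊ toℕ i ℕ.≟ 0 ⌋
                 then sq (+ 1 - ∑ (λ j → X i j))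
                 else sq (+ 1 - ∑ (λ j → X i j) + ∑ (λ r → + (2 ℕ.^ toℕ r) * Y i r))

  P₂ : ℤ
  P₂ = ∑ λ j → sq (∑ (λ (i : Fin (suc nT)) → ⟦ Vars.x v i j ⟧) - + 1)

  P₃ : ℤ
  P₃ = ∑ λ i → ∑ λ j → onTree EN j λ j₁ j₂ →
         X i j₁ * X i j₂ - c2 * X i j₁ * Z i j - c2 * X i j₂ * Z i j + c3 * Z i j

  P₄ : ℤ
  P₄ = ∑ λ i → ∑ λ j → onTree EN j λ _ _ → X i j * Z i j

  P₅ : ℤ
  P₅ = ∑ λ i → ∑ λ j → onRet EN j λ j¹ j² →
         X i j¹ * X i j² - c2 * X i j¹ * Z i j - c2 * X i j² * Z i j + c3 * Z i j

  P₆ : ℤ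
  P₆ = ∑ λ i → ∑ λ j → onRet EN j λ _ _ → X i j * Z i j

  P₇ : ℤ
  P₇ = ∑ λ i → ∑ λ l → ifNe i l (F i l * ∑ λ j → onTree EN j λ _ _ → X i j * Z l j)

  P₈ : ℤ
  P₈ = ∑ λ i → nonLeaf i (∑ λ j → onTree EN j λ j₁ j₂ →
         X i j * X i j₁ - c2 * X i j * Ẑ i j Fin.zero - c2 * X i j₁ * Ẑ i j Fin.zero
           + c3 * Ẑ i j Fin.zero
         + X i j * X i j₂ - c2 * X i j * Ẑ i j (Fin.suc Fin.zero)
           - c2 * X i j₂ * Ẑ i j (Fin.suc Fin.zero) + c3 * Ẑ i j (Fin.suc Fin.zero))

  P₉ : ℤ
  P₉ = ∑ λ i → ∑ λ l → ifNe i l (F i l * ∑ λ j → onTree EN j λ j₁ j₂ →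
         Ẑ i j Fin.zero * X l j₂ + Ẑ i j (Fin.suc Fin.zero) * X l j₁)

  -- sum over the leaves u_i of T, indexed by their labels a ∈ X:
  -- u_i = leaf of T labelled a, v_{ℓ(i)} = leaf of N labelled a.
  P₁₀ : ℤ
  P₁₀ = ∑ λ (a : Fin k) →
          sq (+ 1 - ⟦ Vars.x v (inject₁ (PhyloNet.leafLab (PhyloTree.net T) a))
                               (PhyloNet.leafLab N a) ⟧)

  P₁₁ : ℤ
  P₁₁ = (∑ λ i → ∑ λ j → X i j * (+ 1 - ∑ λ k' → ifNe j k' (G j k' * X i k'))) - + nT

  P₁₂ : ℤ
  P₁₂ = ∑ λ i → ∑ λ l → ifNe i l (F i l *
          (+ 1 - ∑ λ j → ∑ λ k' → ifNe j k' (G j k' * X i j * X l k')))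

  A B : ℤ
  A = + (2 ℕ.* nN)
  B = + (4 ℕ.* nN ℕ.* nN ℕ.* nT ℕ.* nT)

  H : ℤ
  H = B * (P₁ + P₂ + P₃ + P₄ + P₅ + P₆ + P₇ + P₈ + P₉ + P₁₀) + A * P₁₁ + P₁₂

-- P₁, …, P₁₀ are
-- nonnegative: they are sums of squares and of Boolean penalties such as
-- x₁x₂ − 2x₁z − 2x₂z + 3z, which is never negative on {0,1}. Since every vertex
-- of N has out-degree at most 2, P₁₁ ≥ −(n_T n_N + n_T) and P₁₂ ≥ −2 n_T² n_N,
-- and as both networks have at least two vertices, B exceeds A(n_T n_N + n_T) +
-- 2 n_T² n_N. So if P₁ + ⋯ + P₁₀ ≥ 1 then H > 0; hence H = 0 forces that sum, and
-- with it each of its nonnegative summands, to vanish.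

module Submission where

open import Defs
open import Data.Nat using (ℕ; _≤_)
open import Data.Integer using (ℤ; +_)
open import Data.Product using (_×_)
open import Relation.Binary.PropositionalEquality using (_≡_)

open import Data.Bool using (Bool; true; false; _∧_; if_then_else_)
open import Data.Empty using (⊥-elim)
open import Data.Fin as Fin using (Fin; inject₁)
open import Data.List using (List; []; _∷_; length; filterᵇ; tabulate; foldl; allFin)
open import Data.List.Properties using (length-filter; length-tabulate)
open import Data.List.Relation.Unary.All using (All; []; _∷_)
open import Data.Product using (_,_)
open import Data.Sum using (inj₁; inj₂)
open import Function using (_∘_; case_of_)
open import Data.Integer as ℤ using (0ℤ; 1ℤ; _+_; _-_; _*_; -_; +≤+; -[1+_])
import Data.Integer.Properties as ℤP
import Data.Integer.Tactic.RingSolver as ℤSolver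
import Data.Nat as ℕ
import Data.Nat.Properties as ℕP
import Data.Nat.Tactic.RingSolver as ℕSolver
open import Relation.Binary.PropositionalEquality using (refl; sym; trans; cong; subst)
open import Relation.Nullary.Decidable using (T?)

∑-nonneg : ∀ {n} (f : Fin n → ℤ) → (∀ i → 0ℤ ℤ.≤ f i) → 0ℤ ℤ.≤ ∑ f
∑-nonneg {ℕ.zero}  f f≥0 = ℤP.≤-refl
∑-nonneg {ℕ.suc n} f f≥0 =
  ℤP.+-mono-≤ (f≥0 Fin.zero) (∑-nonneg (λ i → f (Fin.suc i)) (λ i → f≥0 (Fin.suc i)))

∑-mono-≤ : ∀ {n} (f g : Fin n → ℤ) → (∀ i → f i ℤ.≤ g i) → ∑ f ℤ.≤ ∑ g
∑-mono-≤ {ℕ.zero}  f g f≤g = ℤP.≤-refl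
∑-mono-≤ {ℕ.suc n} f g f≤g =
  ℤP.+-mono-≤ (f≤g Fin.zero) (∑-mono-≤ (λ i → f (Fin.suc i)) (λ i → g (Fin.suc i)) (λ i → f≤g (Fin.suc i)))

∑-≤-const : ∀ {n} m (f : Fin n → ℤ) → (∀ i → f i ℤ.≤ + m) → ∑ f ℤ.≤ + (n ℕ.* m)
∑-≤-const {ℕ.zero}  m f f≤m = ℤP.≤-refl
∑-≤-const {ℕ.suc n} m f f≤m =
  ℤP.+-mono-≤ (f≤m Fin.zero) (∑-≤-const m (λ i → f (Fin.suc i)) (λ i → f≤m (Fin.suc i)))

∑-≥-const : ∀ {n} m (f : Fin n → ℤ) → (∀ i → - + m ℤ.≤ f i) → - + (n ℕ.* m) ℤ.≤ ∑ f
∑-≥-const {ℕ.zero}  m f f≥-m = ℤP.≤-refl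
∑-≥-const {ℕ.suc n} m f f≥-m =
  subst (ℤ._≤ ∑ f) (sym (ℤP.neg-distrib-+ (+ m) (+ (n ℕ.* m))))
    (ℤP.+-mono-≤ (f≥-m Fin.zero) (∑-≥-const m (λ i → f (Fin.suc i)) (λ i → f≥-m (Fin.suc i))))

∑-⟦⟧≡length-filterᵇ : ∀ {A : Set} {n} (p : A → Bool) (g : Fin n → A) →
                       ∑ (λ i → ⟦ p (g i) ⟧) ≡ + length (filterᵇ p (tabulate g))
∑-⟦⟧≡length-filterᵇ {n = ℕ.zero}  p g = refl
∑-⟦⟧≡length-filterᵇ {n = ℕ.suc n} p g with p (g Fin.zero)
... | true  = cong (λ s → 1ℤ + s) (∑-⟦⟧≡length-filterᵇ p (λ i → g (Fin.suc i)))
... | false = trans (ℤP.+-identityˡ _) (∑-⟦⟧≡length-filterᵇ p (λ i → g (Fin.suc i)))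

foldl-+-nonneg : ∀ {a} {xs : List ℤ} → 0ℤ ℤ.≤ a → All (0ℤ ℤ.≤_) xs → 0ℤ ℤ.≤ foldl _+_ a xs
foldl-+-nonneg a≥0 []          = a≥0
foldl-+-nonneg a≥0 (x≥0 ∷ xs≥0) = foldl-+-nonneg (ℤP.+-mono-≤ a≥0 x≥0) xs≥0

+-nonneg≡0 : ∀ {a b} → 0ℤ ℤ.≤ a → 0ℤ ℤ.≤ b → a + b ≡ 0ℤ → a ≡ 0ℤ × b ≡ 0ℤ
+-nonneg≡0 {+ m} {+ n} _ _ m+n≡0 =
  cong +_ (ℕP.m+n≡0⇒m≡0 m (ℤP.+-injective m+n≡0)) , cong +_ (ℕP.m+n≡0⇒n≡0 m (ℤP.+-injective m+n≡0))

foldl-+-nonneg≡0 : ∀ {a} {xs : List ℤ} → 0ℤ ℤ.≤ a → All (0ℤ ℤ.≤_) xs →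
                   foldl _+_ a xs ≡ 0ℤ → a ≡ 0ℤ × All (_≡ 0ℤ) xs
foldl-+-nonneg≡0 a≥0 []           a≡0 = a≡0 , []
foldl-+-nonneg≡0 a≥0 (x≥0 ∷ xs≥0) sum≡0
  with a+x≡0 , xs≡0 ← foldl-+-nonneg≡0 (ℤP.+-mono-≤ a≥0 x≥0) xs≥0 sum≡0
  with a≡0 , x≡0 ← +-nonneg≡0 a≥0 x≥0 a+x≡0
  = a≡0 , x≡0 ∷ xs≡0

sq-nonneg : ∀ i → 0ℤ ℤ.≤ sq i
sq-nonneg (+ n)    = subst (0ℤ ℤ.≤_) (ℤP.pos-* n n) (+≤+ ℕ.z≤n)
sq-nonneg -[1+ n ] = +≤+ ℕ.z≤n

⟦⟧-nonneg : ∀ b → 0ℤ ℤ.≤ ⟦ b ⟧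
⟦⟧-nonneg true  = +≤+ ℕ.z≤n
⟦⟧-nonneg false = ℤP.≤-refl

⟦∧⟧ : ∀ a b → ⟦ a ⟧ * ⟦ b ⟧ ≡ ⟦ a ∧ b ⟧
⟦∧⟧ true  b = ℤP.*-identityˡ ⟦ b ⟧
⟦∧⟧ false b = refl

⟦⟧*⟦⟧-nonneg : ∀ a b → 0ℤ ℤ.≤ ⟦ a ⟧ * ⟦ b ⟧
⟦⟧*⟦⟧-nonneg a b = subst (0ℤ ℤ.≤_) (sym (⟦∧⟧ a b)) (⟦⟧-nonneg (a ∧ b))

*⟦⟧≤ : ∀ t b → 0ℤ ℤ.≤ t → t * ⟦ b ⟧ ℤ.≤ t
*⟦⟧≤ t true  _   = ℤP.≤-reflexive (ℤP.*-identityʳ t)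
*⟦⟧≤ t false t≥0 = subst (ℤ._≤ t) (sym (ℤP.*-zeroʳ t)) t≥0

⟦⟧*-≥ : ∀ b {c t} → c ℤ.≤ 0ℤ → c ℤ.≤ t → c ℤ.≤ ⟦ b ⟧ * t
⟦⟧*-≥ true  {t = t} _   c≤t = subst (_ ℤ.≤_) (sym (ℤP.*-identityˡ t)) c≤t
⟦⟧*-≥ false         c≤0 _   = c≤0

if-≥ : ∀ b {c s t : ℤ} → c ℤ.≤ s → c ℤ.≤ t → c ℤ.≤ (if b then s else t)
if-≥ true  c≤s _   = c≤s
if-≥ false _   c≤t = c≤t

if-≤ : ∀ b {c s t : ℤ} → s ℤ.≤ c → t ℤ.≤ c → (if b then s else t) ℤ.≤ c
if-≤ true  s≤c _   = s≤c
if-≤ false _   t≤c = t≤c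

i≤1+m⇒-m≤1-i : ∀ m {i} → i ℤ.≤ + ℕ.suc m → - + m ℤ.≤ 1ℤ - i
i≤1+m⇒-m≤1-i m i≤1+m =
  subst (ℤ._≤ _) (1-[1+m]≡-m m) (ℤP.+-monoʳ-≤ 1ℤ (ℤP.neg-mono-≤ i≤1+m))
  where
  1-[1+m]≡-m : ∀ m → 1ℤ - + ℕ.suc m ≡ - + m
  1-[1+m]≡-m ℕ.zero    = refl
  1-[1+m]≡-m (ℕ.suc m) = ℤP.[1+m]⊖[1+n]≡m⊖n 0 (ℕ.suc m)

-- Penalty for the constraint c = a ∧ b: on Booleans it is 0 iff c = a ∧ b, and positive otherwise.

andPenalty : ℤ → ℤ → ℤ → ℤ
andPenalty a b c = a * b - + 2 * a * c - + 2 * b * c + + 3 * c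

andPenalty-nonneg : ∀ a b c → 0ℤ ℤ.≤ andPenalty ⟦ a ⟧ ⟦ b ⟧ ⟦ c ⟧
andPenalty-nonneg true  true  true  = +≤+ ℕ.z≤n
andPenalty-nonneg true  true  false = +≤+ ℕ.z≤n
andPenalty-nonneg true  false true  = +≤+ ℕ.z≤n
andPenalty-nonneg true  false false = +≤+ ℕ.z≤n
andPenalty-nonneg false true  true  = +≤+ ℕ.z≤n
andPenalty-nonneg false true  false = +≤+ ℕ.z≤n
andPenalty-nonneg false false true  = +≤+ ℕ.z≤n
andPenalty-nonneg false false false = +≤+ ℕ.z≤n

andPenalty-+ : ∀ a b c d e →
  a * b - + 2 * a * c - + 2 * b * c + + 3 * c + a * d - + 2 * a * e - + 2 * d * e + + 3 * e
    ≡ andPenalty a b c + andPenalty a d e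
andPenalty-+ a b c d e =
  +-reassoc (andPenalty a b c) (a * d) (- (+ 2 * a * e)) (- (+ 2 * d * e)) (+ 3 * e)
  where
  +-reassoc : ∀ g x₁ x₂ x₃ x₄ → g + x₁ + x₂ + x₃ + x₄ ≡ g + (x₁ + x₂ + x₃ + x₄)
  +-reassoc = ℤSolver.solve-∀

onTree-nonneg : ∀ {n} (E : Digraph n) j t → (∀ a b → 0ℤ ℤ.≤ t a b) → 0ℤ ℤ.≤ onTree E j t
onTree-nonneg E j t t≥0 with children E j
... | []              = ℤP.≤-refl
... | _ ∷ []          = ℤP.≤-refl
... | a ∷ b ∷ []      = t≥0 a b
... | _ ∷ _ ∷ _ ∷ _   = ℤP.≤-refl

onRet-nonneg : ∀ {n} (E : Digraph n) j t → (∀ a b → 0ℤ ℤ.≤ t a b) → 0ℤ ℤ.≤ onRet E j t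
onRet-nonneg E j t t≥0 with parents E j
... | []              = ℤP.≤-refl
... | _ ∷ []          = ℤP.≤-refl
... | a ∷ b ∷ []      = t≥0 a b
... | _ ∷ _ ∷ _ ∷ _   = ℤP.≤-refl

outdeg≤size : ∀ {n} (E : Digraph n) v → outdeg E v ℕ.≤ n
outdeg≤size {n} E v = subst (outdeg E v ℕ.≤_) (length-tabulate (λ w → w))
                        (length-filter (T? ∘ E v) (allFin n))

outdeg≤2 : ∀ {n k} (N : PhyloNet n k) v → outdeg (PhyloNet.E N) v ℕ.≤ 2
outdeg≤2 N v with PhyloNet.degrees N v
... | inj₁ refl rewrite PhyloNet.root-out N   = ℕP.≤-refl
... | inj₂ (inj₁ (_ , out≡0))                 rewrite out≡0 = ℕ.z≤n
... | inj₂ (inj₂ (inj₁ (_ , out≡2)))          rewrite out≡2 = ℕP.≤-refl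
... | inj₂ (inj₂ (inj₂ (_ , out≡1)))          rewrite out≡1 = ℕ.s≤s ℕ.z≤n

2≤size : ∀ {n k} → PhyloNet n k → 2 ℕ.≤ n
2≤size N = subst (ℕ._≤ _) (PhyloNet.root-out N) (outdeg≤size (PhyloNet.E N) (PhyloNet.root N))

∑-out-edges≤2 : ∀ {n k} (N : PhyloNet n k) j (w : Fin n → ℤ) →
                (∀ i → w i ℤ.≤ ⟦ PhyloNet.E N j i ⟧) → ∑ w ℤ.≤ + 2
∑-out-edges≤2 N j w w≤edge = begin
  ∑ w                            ≤⟨ ∑-mono-≤ w _ w≤edge ⟩
  ∑ (λ i → ⟦ PhyloNet.E N j i ⟧) ≡⟨ ∑-⟦⟧≡length-filterᵇ (PhyloNet.E N j) (λ i → i) ⟩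
  + outdeg (PhyloNet.E N) j      ≤⟨ +≤+ (outdeg≤2 N j) ⟩
  + 2                            ∎
  where open ℤP.≤-Reasoning

-m≤i⇒0≤i+m : ∀ {m i} → - + m ℤ.≤ i → 0ℤ ℤ.≤ i + + m
-m≤i⇒0≤i+m {m} {i} -m≤i = subst (ℤ._≤ i + + m) (ℤP.+-inverseˡ (+ m)) (ℤP.+-monoˡ-≤ (+ m) -m≤i)

dominant-summand≡0 : ∀ {b} A {a c} {S P Q : ℤ} → A ℕ.* a ℕ.+ c ℕ.< b →
                     0ℤ ℤ.≤ S → - + a ℤ.≤ P → - + c ℤ.≤ Q →
                     + b * S + + A * P + Q ≡ 0ℤ → S ≡ 0ℤ
dominant-summand≡0 A {S = + 0} _ _ _ _ _ = refl
dominant-summand≡0 {b} A {a} {c} {S@(+ ℕ.suc _)} {P} {Q} Aa+c<b _ P≥-a Q≥-c sum≡0 =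
  ⊥-elim (ℕP.<⇒≱ Aa+c<b (ℤP.drop‿+≤+ b≤Aa+c))
  where
  open ℤP.≤-Reasoning
  b≤Aa+c : + b ℤ.≤ + (A ℕ.* a ℕ.+ c)
  b≤Aa+c = begin
    + b                                        ≡⟨ ℤP.*-identityʳ (+ b) ⟨
    + b * 1ℤ                                   ≤⟨ ℤP.*-monoˡ-≤-nonNeg (+ b) (+≤+ (ℕ.s≤s ℕ.z≤n)) ⟩
    + b * S                                    ≡⟨ trans (ℤP.+-identityʳ _) (ℤP.+-identityʳ _) ⟨
    + b * S + 0ℤ + 0ℤ                          ≤⟨ ℤP.+-mono-≤ (ℤP.+-monoʳ-≤ (+ b * S) A[P+a]≥0)
                                                              (-m≤i⇒0≤i+m Q≥-c) ⟩
    + b * S + + A * (P + + a) + (Q + + c)      ≡⟨ regroup (+ b * S) (+ A) P Q (+ a) (+ c) ⟩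
    (+ b * S + + A * P + Q) + (+ A * + a + + c) ≡⟨ cong (_+ (+ A * + a + + c)) sum≡0 ⟩
    0ℤ + (+ A * + a + + c)                     ≡⟨ ℤP.+-identityˡ _ ⟩
    + A * + a + + c                            ≡⟨ cong (_+ + c) (ℤP.pos-* A a) ⟨
    + (A ℕ.* a ℕ.+ c)                          ∎
    where
    A[P+a]≥0 : 0ℤ ℤ.≤ + A * (P + + a)
    A[P+a]≥0 = subst (ℤ._≤ + A * (P + + a)) (ℤP.*-zeroʳ (+ A))
                 (ℤP.*-monoˡ-≤-nonNeg (+ A) (-m≤i⇒0≤i+m P≥-a))
    regroup : ∀ x y p q a c → x + y * (p + a) + (q + c) ≡ (x + y * p + q) + (y * a + c)
    regroup = ℤSolver.solve-∀

weights-dominate : ∀ {N T} → 2 ℕ.≤ N → 2 ℕ.≤ T →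
  2 ℕ.* N ℕ.* (T ℕ.* N ℕ.+ T) ℕ.+ T ℕ.* (T ℕ.* (N ℕ.* 2)) ℕ.< 4 ℕ.* N ℕ.* N ℕ.* T ℕ.* T
weights-dominate {ℕ.suc (ℕ.suc a)} {ℕ.suc (ℕ.suc b)} (ℕ.s≤s (ℕ.s≤s _)) (ℕ.s≤s (ℕ.s≤s _)) =
  ℕP.≤-trans (ℕP.m≤m+n _ _) (ℕP.≤-reflexive (expand a b))
  where
  -- the added polynomial is the gap between the two sides, minus 1, in terms of N - 2 and T - 2
  expand : ∀ a b → let N = 2 ℕ.+ a; T = 2 ℕ.+ b in
    ℕ.suc (2 ℕ.* N ℕ.* (T ℕ.* N ℕ.+ T) ℕ.+ T ℕ.* (T ℕ.* (N ℕ.* 2)))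
      ℕ.+ (23 ℕ.+ 36 ℕ.* b ℕ.+ 12 ℕ.* b ℕ.* b
           ℕ.+ a ℕ.* (36 ℕ.+ 46 ℕ.* b ℕ.+ 14 ℕ.* b ℕ.* b)
           ℕ.+ a ℕ.* a ℕ.* (12 ℕ.+ 14 ℕ.* b ℕ.+ 4 ℕ.* b ℕ.* b))
    ≡ 4 ℕ.* N ℕ.* N ℕ.* T ℕ.* T
  expand = ℕSolver.solve-∀

module PenaltyBounds {nN nT k : ℕ} (N : PhyloNet nN k) (T : PhyloTree nT k) (v : Vars nN nT) where

  open QUBO N T v
  open Vars v

  private
    EN : Digraph nN
    EN = PhyloNet.E N
    ET : Digraph nT
    ET = PhyloNet.E (PhyloTree.net T)
    xT : Fin nT → Fin nN → Bool
    xT i = x (inject₁ i)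

  P₁-nonneg : 0ℤ ℤ.≤ P₁
  P₁-nonneg = ∑-nonneg {nT} _ λ i → if-≥ _ (sq-nonneg (+ 1 - ∑ λ j → ⟦ xT i j ⟧))
                (sq-nonneg (+ 1 - ∑ (λ j → ⟦ xT i j ⟧) + ∑ λ r → + (2 ℕ.^ Fin.toℕ r) * ⟦ y i r ⟧))

  P₂-nonneg : 0ℤ ℤ.≤ P₂
  P₂-nonneg = ∑-nonneg {nN} _ λ j → sq-nonneg (∑ (λ i → ⟦ x i j ⟧) - + 1)

  P₃-nonneg : 0ℤ ℤ.≤ P₃
  P₃-nonneg = ∑-nonneg _ λ i → ∑-nonneg _ λ j → onTree-nonneg EN j _ λ a b →
                andPenalty-nonneg (xT i a) (xT i b) (z i j)

  P₄-nonneg : 0ℤ ℤ.≤ P₄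
  P₄-nonneg = ∑-nonneg _ λ i → ∑-nonneg _ λ j → onTree-nonneg EN j _ λ _ _ →
                ⟦⟧*⟦⟧-nonneg (xT i j) (z i j)

  P₅-nonneg : 0ℤ ℤ.≤ P₅
  P₅-nonneg = ∑-nonneg _ λ i → ∑-nonneg _ λ j → onRet-nonneg EN j _ λ a b →
                andPenalty-nonneg (xT i a) (xT i b) (z i j)

  P₆-nonneg : 0ℤ ℤ.≤ P₆
  P₆-nonneg = ∑-nonneg _ λ i → ∑-nonneg _ λ j → onRet-nonneg EN j _ λ _ _ →
                ⟦⟧*⟦⟧-nonneg (xT i j) (z i j)

  P₇-nonneg : 0ℤ ℤ.≤ P₇
  P₇-nonneg = ∑-nonneg _ λ i → ∑-nonneg _ λ l → if-≥ _ ℤP.≤-refl (⟦⟧*-≥ (ET i l) ℤP.≤-refl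
                (∑-nonneg _ λ j → onTree-nonneg EN j _ λ _ _ → ⟦⟧*⟦⟧-nonneg (xT i j) (z l j)))

  P₈-nonneg : 0ℤ ℤ.≤ P₈
  P₈-nonneg = ∑-nonneg _ λ i → if-≥ _ ℤP.≤-refl (∑-nonneg _ λ j → onTree-nonneg EN j _ λ a b →
                subst (0ℤ ℤ.≤_) (sym (andPenalty-+ ⟦ xT i j ⟧ ⟦ xT i a ⟧ ⟦ ẑ i j Fin.zero ⟧
                                                   ⟦ xT i b ⟧ ⟦ ẑ i j (Fin.suc Fin.zero) ⟧))
                  (ℤP.+-mono-≤ (andPenalty-nonneg (xT i j) (xT i a) (ẑ i j Fin.zero))
                               (andPenalty-nonneg (xT i j) (xT i b) (ẑ i j (Fin.suc Fin.zero)))))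

  P₉-nonneg : 0ℤ ℤ.≤ P₉
  P₉-nonneg = ∑-nonneg _ λ i → ∑-nonneg _ λ l → if-≥ _ ℤP.≤-refl (⟦⟧*-≥ (ET i l) ℤP.≤-refl
                (∑-nonneg _ λ j → onTree-nonneg EN j _ λ a b →
                  ℤP.+-mono-≤ (⟦⟧*⟦⟧-nonneg (ẑ i j Fin.zero) (xT l b))
                              (⟦⟧*⟦⟧-nonneg (ẑ i j (Fin.suc Fin.zero)) (xT l a))))

  P₁₀-nonneg : 0ℤ ℤ.≤ P₁₀
  P₁₀-nonneg = ∑-nonneg {k} _ λ a →
    sq-nonneg (+ 1 - ⟦ x (inject₁ (PhyloNet.leafLab (PhyloTree.net T) a)) (PhyloNet.leafLab N a) ⟧)

  P₁₁-≥ : - + (nT ℕ.* nN ℕ.+ nT) ℤ.≤ P₁₁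
  P₁₁-≥ = subst (ℤ._≤ P₁₁) regroup
            (ℤP.+-monoˡ-≤ (- + nT) (∑-≥-const _ _ λ i → ∑-≥-const 1 _ λ j →
              ⟦⟧*-≥ (xT i j) ℤP.neg-≤-pos (i≤1+m⇒-m≤1-i 1 (∑-out-edges≤2 N j _ λ k' →
                if-≤ _ (⟦⟧-nonneg _) (*⟦⟧≤ _ (xT i k') (⟦⟧-nonneg _))))))
    where
    regroup : - + (nT ℕ.* (nN ℕ.* 1)) - + nT ≡ - + (nT ℕ.* nN ℕ.+ nT)
    regroup = trans (sym (ℤP.neg-distrib-+ (+ (nT ℕ.* (nN ℕ.* 1))) (+ nT)))
                    (cong (λ m → - + (nT ℕ.* m ℕ.+ nT)) (ℕP.*-identityʳ nN))

  P₁₂-≥ : - + (nT ℕ.* (nT ℕ.* (nN ℕ.* 2))) ℤ.≤ P₁₂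
  P₁₂-≥ = ∑-≥-const _ _ λ i → ∑-≥-const _ _ λ l → if-≥ _ ℤP.neg-≤-pos (⟦⟧*-≥ (ET i l) ℤP.neg-≤-pos
            (i≤1+m⇒-m≤1-i (nN ℕ.* 2) (ℤP.≤-trans (edges≤ i l) (+≤+ (ℕP.n≤1+n _)))))
    where
    edges≤ : ∀ i l → ∑ (λ j → ∑ λ k' → ifNe j k' (⟦ EN j k' ⟧ * ⟦ xT i j ⟧ * ⟦ xT l k' ⟧))
                     ℤ.≤ + (nN ℕ.* 2)
    edges≤ i l = ∑-≤-const 2 _ λ j → ∑-out-edges≤2 N j _ λ k' → if-≤ _ (⟦⟧-nonneg _)
                   (ℤP.≤-trans (*⟦⟧≤ _ (xT l k') (⟦⟧*⟦⟧-nonneg (EN j k') (xT i j)))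
                               (*⟦⟧≤ _ (xT i j) (⟦⟧-nonneg (EN j k'))))

lemma17 : ∀ {nN nT k : ℕ} (N : PhyloNet nN k) (T : PhyloTree nT k) →
          nT ≤ nN → (v : Vars nN nT) →
          QUBO.H N T v ≡ + 0 →
          QUBO.P₁ N T v ≡ + 0 × QUBO.P₂ N T v ≡ + 0 × QUBO.P₃ N T v ≡ + 0 ×
          QUBO.P₄ N T v ≡ + 0 × QUBO.P₅ N T v ≡ + 0 × QUBO.P₆ N T v ≡ + 0 ×
          QUBO.P₇ N T v ≡ + 0 × QUBO.P₈ N T v ≡ + 0 × QUBO.P₉ N T v ≡ + 0 ×
          QUBO.P₁₀ N T v ≡ + 0
-- The hypothesis nT ≤ nN only serves to define s; the argument does not need it.
lemma17 {nN} N T _ v H≡0 =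
  case foldl-+-nonneg≡0 P₁-nonneg P₂…P₁₀-nonneg S≡0 of λ where
    (P₁≡0 , P₂≡0 ∷ P₃≡0 ∷ P₄≡0 ∷ P₅≡0 ∷ P₆≡0 ∷ P₇≡0 ∷ P₈≡0 ∷ P₉≡0 ∷ P₁₀≡0 ∷ []) →
      P₁≡0 , P₂≡0 , P₃≡0 , P₄≡0 , P₅≡0 , P₆≡0 , P₇≡0 , P₈≡0 , P₉≡0 , P₁₀≡0
  where
  open QUBO N T v
  open PenaltyBounds N T v
  P₂…P₁₀-nonneg : All (0ℤ ℤ.≤_) (P₂ ∷ P₃ ∷ P₄ ∷ P₅ ∷ P₆ ∷ P₇ ∷ P₈ ∷ P₉ ∷ P₁₀ ∷ [])
  P₂…P₁₀-nonneg = P₂-nonneg ∷ P₃-nonneg ∷ P₄-nonneg ∷ P₅-nonneg ∷ P₆-nonneg ∷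
                  P₇-nonneg ∷ P₈-nonneg ∷ P₉-nonneg ∷ P₁₀-nonneg ∷ []
  S≡0 : P₁ + P₂ + P₃ + P₄ + P₅ + P₆ + P₇ + P₈ + P₉ + P₁₀ ≡ 0ℤ
  S≡0 = dominant-summand≡0 (2 ℕ.* nN) (weights-dominate (2≤size N) (2≤size (PhyloTree.net T)))
          (foldl-+-nonneg P₁-nonneg P₂…P₁₀-nonneg) P₁₁-≥ P₁₂-≥ H≡0
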